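{- For every multiset type $\Sigma$ there is $k\in\{0,1,\ldots\}$ such that $\Sigma$ encodes into $\mathsf M^k 1$, i.e.\ there are derivable functions $\mathit{encode}:\Sigma\to\mathsf M^k1$ and $\mathit{decode}:\mathsf M^k1\to\Sigma$ such that $\mathit{encode};\mathit{decode}$ (first $\mathit{encode}$, then $\mathit{decode}$) is the identity on $\Sigma$.
   Context: Multiset types are the types generated by the constructors $1$ (a one-element set), $\Sigma+\Gamma$ (disjoint union), $\Sigma\times\Gamma$ (product) and $\mathsf M\Sigma$ (finite multisets over $\Sigma$); each denotes the evident set of values. $\mathsf M^k 1$ is $\mathsf M$ applied $k$ times to $1$ (unordered trees of height at most $k$). $\mathbf{Bool}=1+1$. The derivable functions are the least class of functions between multiset types that contains, for all multiset types $\Sigma,\Sigma_1,\Sigma_2$, the prime functions: $\mathit{union}:\mathsf M\mathsf M\Sigma\to\mathsf M\Sigma$ (multiset union); $\mathit{add}:\Sigma\times\mathsf M\Sigma\to\mathsf M\Sigma$ (add one element); $\mathit{choices}:\mathsf M\Sigma\to\mathsf M(\Sigma\times\mathsf M\Sigma)$ mapping $\{\!\{A_1,\ldots,A_n\}\!\}$ to $\{\!\{(A_1,B_1),\ldots,(A_n,B_n)\}\!\}$ with $B_i=\{\!\{A_1,\ldots,A_n\}\!\}-\{\!\{A_i\}\!\}$; $\mathit{de\text{ - }singleton}:\mathsf M\Sigma\to1+\Sigma$ mapping a singleton multiset to its unique element (in the right summand) and every other multiset to the element of $1$; $\mathit{empty}:1\to\mathsf M1$ (constant empty multiset); identity $\Sigma\to\Sigma$;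 projections $\Sigma_1\times\Sigma_2\to\Sigma_i$; coprojections $\Sigma_i\to\Sigma_1+\Sigma_2$; $\mathit{dist}:\Sigma\times(\Sigma_1+\Sigma_2)\to\Sigma\times\Sigma_1+\Sigma\times\Sigma_2$; and that is closed under pairing ($f_1:\Sigma\to\Gamma_1$, $f_2:\Sigma\to\Gamma_2$ give $\langle f_1,f_2\rangle:\Sigma\to\Gamma_1\times\Gamma_2$), co-pairing ($f_1:\Sigma_1\to\Gamma$, $f_2:\Sigma_2\to\Gamma$ give $[f_1,f_2]:\Sigma_1+\Sigma_2\to\Gamma$), mapping ($f:\Sigma\to\Gamma$ gives $\mathsf Mf:\mathsf M\Sigma\to\mathsf M\Gamma$ applied elementwise) and composition. -}

module Defs where

open import Data.Nat using (ℕ; zero; suc)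
open import Data.List using (List; []; _∷_; map; concatMap)
open import Data.Product using (_×_; _,_)
open import Data.List.Relation.Binary.Permutation.Homogeneous using (Permutation)

infixr 5 _⊕_
infixr 6 _⊗_

data Ty : Set where
  𝟙   : Ty
  _⊕_ : Ty → Ty → Ty
  _⊗_ : Ty → Ty → Ty
  M   : Ty → Ty

Mpow : ℕ → Ty
Mpow zero = 𝟙
Mpow (suc k) = M (Mpow k)

Bool' : Ty
Bool' = 𝟙 ⊕ 𝟙

-- Representatives of values; a finite multiset is represented by a list,
-- and values are identified up to _≈_ (permutation, recursively).
data Val : Ty → Set where
  tt   : Val 𝟙
  inl  : ∀ {σ τ} → Val σ → Val (σ ⊕ τ)
  inr  : ∀ {σ τ} → Val τ → Val (σ ⊕ τ)
  pair : ∀ {σ τ} → Val σ → Val τ → Val (σ ⊗ τ)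
  bag  : ∀ {σ} → List (Val σ) → Val (M σ)

data _≈_ : ∀ {σ} → Val σ → Val σ → Set where
  tt≈   : tt ≈ tt
  inl≈  : ∀ {σ τ} {x y : Val σ} → x ≈ y → inl {σ} {τ} x ≈ inl y
  inr≈  : ∀ {σ τ} {x y : Val τ} → x ≈ y → inr {σ} {τ} x ≈ inr y
  pair≈ : ∀ {σ τ} {x x′ : Val σ} {y y′ : Val τ} → x ≈ x′ → y ≈ y′ → pair x y ≈ pair x′ y′
  bag≈  : ∀ {σ} {xs ys : List (Val σ)} → Permutation (_≈_ {σ}) xs ys → bag xs ≈ bag ys

data Der : Ty → Ty → Set where
  union        : ∀ {σ} → Der (M (M σ)) (M σ)
  add          : ∀ {σ} → Der (σ ⊗ M σ) (M σ)
  choices      : ∀ {σ} → Der (M σ) (M (σ ⊗ M σ))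
  de-singleton : ∀ {σ} → Der (M σ) (𝟙 ⊕ σ)
  empty        : Der 𝟙 (M 𝟙)
  id           : ∀ {σ} → Der σ σ
  π₁           : ∀ {σ₁ σ₂} → Der (σ₁ ⊗ σ₂) σ₁
  π₂           : ∀ {σ₁ σ₂} → Der (σ₁ ⊗ σ₂) σ₂
  ι₁           : ∀ {σ₁ σ₂} → Der σ₁ (σ₁ ⊕ σ₂)
  ι₂           : ∀ {σ₁ σ₂} → Der σ₂ (σ₁ ⊕ σ₂)
  dist         : ∀ {σ σ₁ σ₂} → Der (σ ⊗ (σ₁ ⊕ σ₂)) (σ ⊗ σ₁ ⊕ σ ⊗ σ₂)
  ⟨_,_⟩        : ∀ {σ γ₁ γ₂} → Der σ γ₁ → Der σ γ₂ → Der σ (γ₁ ⊗ γ₂)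
  [_,_]        : ∀ {σ₁ σ₂ γ} → Der σ₁ γ → Der σ₂ γ → Der (σ₁ ⊕ σ₂) γ
  mapM         : ∀ {σ γ} → Der σ γ → Der (M σ) (M γ)
  _⨾_          : ∀ {σ τ γ} → Der σ τ → Der τ γ → Der σ γ

elems : ∀ {σ} → Val (M σ) → List (Val σ)
elems (bag xs) = xs

choicesL : ∀ {σ} → List (Val σ) → List (Val (σ ⊗ M σ))
choicesL [] = []
choicesL (x ∷ xs) = pair x (bag xs) ∷ map (λ { (pair y (bag ys)) → pair y (bag (x ∷ ys)) }) (choicesL xs)

desingL : ∀ {σ} → List (Val σ) → Val (𝟙 ⊕ σ)
desingL (x ∷ []) = inr x
desingL _ = inl tt

⟦_⟧ : ∀ {σ τ} → Der σ τ → Val σ → Val τ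
⟦ union ⟧ (bag xss) = bag (concatMap elems xss)
⟦ add ⟧ (pair x (bag xs)) = bag (x ∷ xs)
⟦ choices ⟧ (bag xs) = bag (choicesL xs)
⟦ de-singleton ⟧ (bag xs) = desingL xs
⟦ empty ⟧ tt = bag []
⟦ id ⟧ x = x
⟦ π₁ ⟧ (pair x y) = x
⟦ π₂ ⟧ (pair x y) = y
⟦ ι₁ ⟧ x = inl x
⟦ ι₂ ⟧ x = inr x
⟦ dist ⟧ (pair x (inl y)) = inl (pair x y)
⟦ dist ⟧ (pair x (inr y)) = inr (pair x y)
⟦ ⟨ f , g ⟩ ⟧ x = pair (⟦ f ⟧ x) (⟦ g ⟧ x)
⟦ [ f , g ] ⟧ (inl x) = ⟦ f ⟧ x
⟦ [ f , g ] ⟧ (inr x) = ⟦ g ⟧ x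
⟦ mapM f ⟧ (bag xs) = bag (map ⟦ f ⟧ xs)
⟦ f ⨾ g ⟧ x = ⟦ g ⟧ (⟦ f ⟧ x)

-- Retracts compose, and the singleton map makes σ a retract of M σ, so depths can always be
-- raised to a common one. Multisets are encoded elementwise. A sum is encoded by sending inl x
-- to {{x}} and inr y to {{y}, {}}, which de-singleton tells apart; a pair (a , b) becomes the
-- two-element multiset {inl a, inr b} of codes for σ ⊕ τ, from which each component is
-- recovered as the union of the singletons built from its side of the sum.
module Submission where

open import Defs
open import Data.Nat using (ℕ; suc; _⊔_; _≤′_; ≤′-reflexive; ≤′-step)
open import Data.Nat.Properties using (m≤m⊔n; m≤n⊔m; ≤⇒≤′)
open import Data.Product using (Σ; _,_)
open import Data.List using (List; []; _∷_; map)
open import Data.List.Relation.Binary.Permutation.Homogeneous using (Permutation; prep; refl)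
open import Data.List.Relation.Binary.Pointwise using ([])
open import Relation.Binary.PropositionalEquality
  using (_≡_; cong; cong₂; module ≡-Reasoning) renaming (refl to ≡-refl)

mutual
  ≈-refl : ∀ {σ} (x : Val σ) → x ≈ x
  ≈-refl tt         = tt≈
  ≈-refl (inl x)    = inl≈ (≈-refl x)
  ≈-refl (inr x)    = inr≈ (≈-refl x)
  ≈-refl (pair x y) = pair≈ (≈-refl x) (≈-refl y)
  ≈-refl (bag xs)   = bag≈ (↭-refl xs)

  ↭-refl : ∀ {σ} (xs : List (Val σ)) → Permutation (_≈_ {σ}) xs xs
  ↭-refl []       = refl []
  ↭-refl (x ∷ xs) = prep (≈-refl x) (↭-refl xs)

≡⇒≈ : ∀ {σ} {x y : Val σ} → x ≡ y → x ≈ y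
≡⇒≈ {x = x} ≡-refl = ≈-refl x

point : ∀ σ → Der 𝟙 σ
point 𝟙       = id
point (σ ⊕ τ) = point σ ⨾ ι₁
point (σ ⊗ τ) = ⟨ point σ , point τ ⟩
point (M σ)   = empty ⨾ mapM (point σ)

erase : ∀ σ → Der σ 𝟙
erase 𝟙       = id
erase (σ ⊕ τ) = [ erase σ , erase τ ]
erase (σ ⊗ τ) = π₁ ⨾ erase σ
erase (M σ)   = mapM (erase σ) ⨾ (de-singleton ⨾ [ id , id ])

⟦erase⟧ : ∀ σ (x : Val σ) → ⟦ erase σ ⟧ x ≡ tt
⟦erase⟧ 𝟙       tt                 = ≡-refl
⟦erase⟧ (σ ⊕ τ) (inl x)            = ⟦erase⟧ σ x
⟦erase⟧ (σ ⊕ τ) (inr y)            = ⟦erase⟧ τ y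
⟦erase⟧ (σ ⊗ τ) (pair x y)         = ⟦erase⟧ σ x
⟦erase⟧ (M σ)   (bag [])           = ≡-refl
⟦erase⟧ (M σ)   (bag (x ∷ []))     = ⟦erase⟧ σ x
⟦erase⟧ (M σ)   (bag (x ∷ y ∷ xs)) = ≡-refl

emptyOf : ∀ ρ σ → Der ρ (M σ)
emptyOf ρ σ = erase ρ ⨾ point (M σ)

⟦emptyOf⟧ : ∀ ρ σ (x : Val ρ) → ⟦ emptyOf ρ σ ⟧ x ≡ bag []
⟦emptyOf⟧ ρ σ x rewrite ⟦erase⟧ ρ x = ≡-refl

cons : ∀ {ρ σ} → Der ρ σ → Der ρ (M σ) → Der ρ (M σ)
cons f g = ⟨ f , g ⟩ ⨾ add

⟦cons⟧ : ∀ {ρ σ} (f : Der ρ σ) (g : Der ρ (M σ)) {x : Val ρ} {ys : List (Val σ)} →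
         ⟦ g ⟧ x ≡ bag ys → ⟦ cons f g ⟧ x ≡ bag (⟦ f ⟧ x ∷ ys)
⟦cons⟧ f g eq rewrite eq = ≡-refl

doubleton : ∀ {ρ σ} → Der ρ σ → Der ρ σ → Der ρ (M σ)
doubleton {ρ} {σ} f g = cons f (cons g (emptyOf ρ σ))

⟦doubleton⟧ : ∀ {ρ σ} (f g : Der ρ σ) (x : Val ρ) →
              ⟦ doubleton f g ⟧ x ≡ bag (⟦ f ⟧ x ∷ ⟦ g ⟧ x ∷ [])
⟦doubleton⟧ {ρ} {σ} f g x = ⟦cons⟧ f (cons g (emptyOf ρ σ)) (⟦cons⟧ g (emptyOf ρ σ) (⟦emptyOf⟧ ρ σ x))

singleton : ∀ σ → Der σ (M σ)
singleton σ = cons id (emptyOf σ σ)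

⟦singleton⟧ : ∀ σ (x : Val σ) → ⟦ singleton σ ⟧ x ≡ bag (x ∷ [])
⟦singleton⟧ σ x = ⟦cons⟧ id (emptyOf σ σ) (⟦emptyOf⟧ σ σ x)

unsingleton : ∀ σ → Der (M σ) σ
unsingleton σ = de-singleton ⨾ [ point σ , id ]

caseSingleton : ∀ {σ γ} → Der (M σ) γ → Der σ γ → Der (M σ) γ
caseSingleton f g = ⟨ id , de-singleton ⟩ ⨾ (dist ⨾ [ π₁ ⨾ f , π₂ ⨾ g ])

unionOfSingletons : ∀ σ → Der (M (M σ)) (M σ)
unionOfSingletons σ = mapM (caseSingleton (emptyOf (M σ) σ) (singleton σ)) ⨾ union

⟦unionOfSingletons⟧ : ∀ σ (x : Val σ) →
                      ⟦ unionOfSingletons σ ⟧ (bag (bag (x ∷ []) ∷ bag [] ∷ [])) ≡ bag (x ∷ [])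
⟦unionOfSingletons⟧ σ x rewrite ⟦singleton⟧ σ x | ⟦emptyOf⟧ (M σ) σ (bag []) = ≡-refl

fromLeft : ∀ σ τ → Der (M (σ ⊕ τ)) σ
fromLeft σ τ = mapM [ singleton σ , emptyOf τ σ ] ⨾ (union ⨾ unsingleton σ)

fromRight : ∀ σ τ → Der (M (σ ⊕ τ)) τ
fromRight σ τ = mapM [ emptyOf σ τ , singleton τ ] ⨾ (union ⨾ unsingleton τ)

⟦fromLeft⟧ : ∀ {σ τ} (a : Val σ) (b : Val τ) → ⟦ fromLeft σ τ ⟧ (bag (inl a ∷ inr b ∷ [])) ≡ a
⟦fromLeft⟧ {σ} {τ} a b rewrite ⟦singleton⟧ σ a | ⟦emptyOf⟧ τ σ b = ≡-refl

⟦fromRight⟧ : ∀ {σ τ} (a : Val σ) (b : Val τ) → ⟦ fromRight σ τ ⟧ (bag (inl a ∷ inr b ∷ [])) ≡ b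
⟦fromRight⟧ {σ} {τ} a b rewrite ⟦singleton⟧ τ b | ⟦emptyOf⟧ σ τ a = ≡-refl

record Retract (σ τ : Ty) : Set where
  field
    encode        : Der σ τ
    decode        : Der τ σ
    decode-encode : ∀ x → ⟦ decode ⟧ (⟦ encode ⟧ x) ≡ x
open Retract

Retract-refl : ∀ {σ} → Retract σ σ
Retract-refl = record { encode = id ; decode = id ; decode-encode = λ _ → ≡-refl }

Retract-trans : ∀ {σ τ ρ} → Retract σ τ → Retract τ ρ → Retract σ ρ
Retract-trans R S = record
  { encode        = encode R ⨾ encode S
  ; decode        = decode S ⨾ decode R
  ; decode-encode = λ x → begin
      ⟦ decode R ⟧ (⟦ decode S ⟧ (⟦ encode S ⟧ (⟦ encode R ⟧ x)))
        ≡⟨ cong ⟦ decode R ⟧ (decode-encode S (⟦ encode R ⟧ x)) ⟩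
      ⟦ decode R ⟧ (⟦ encode R ⟧ x)
        ≡⟨ decode-encode R x ⟩
      x ∎
  }
  where open ≡-Reasoning

singletonRetract : ∀ σ → Retract σ (M σ)
singletonRetract σ = record
  { encode        = singleton σ
  ; decode        = unsingleton σ
  ; decode-encode = λ x → cong ⟦ unsingleton σ ⟧ (⟦singleton⟧ σ x)
  }

mapRetract : ∀ {σ τ} → Retract σ τ → Retract (M σ) (M τ)
mapRetract {σ} R = record
  { encode        = mapM (encode R)
  ; decode        = mapM (decode R)
  ; decode-encode = λ { (bag xs) → cong bag (map-decode-encode xs) }
  }
  where
  map-decode-encode : (xs : List (Val σ)) →
                      map ⟦ decode R ⟧ (map ⟦ encode R ⟧ xs) ≡ xs
  map-decode-encode []       = ≡-refl
  map-decode-encode (x ∷ xs) = cong₂ _∷_ (decode-encode R x) (map-decode-encode xs)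

sumRetract : ∀ {σ τ L} → Retract σ L → Retract τ L → Retract (σ ⊕ τ) (M (M L))
sumRetract {σ} {τ} {L} R S = record { encode = enc ; decode = dec ; decode-encode = dec-enc }
  where
  enc : Der (σ ⊕ τ) (M (M L))
  enc = [ encode R ⨾ (singleton L ⨾ singleton (M L))
        , doubleton (encode S ⨾ singleton L) (emptyOf τ L) ]

  dec : Der (M (M L)) (σ ⊕ τ)
  dec = caseSingleton (unionOfSingletons L ⨾ (unsingleton L ⨾ (decode S ⨾ ι₂)))
                      (unsingleton L ⨾ (decode R ⨾ ι₁))

  open ≡-Reasoning

  dec-enc : ∀ x → ⟦ dec ⟧ (⟦ enc ⟧ x) ≡ x
  dec-enc (inl x) = begin
    ⟦ dec ⟧ (⟦ singleton (M L) ⟧ (⟦ singleton L ⟧ e))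
      ≡⟨ cong ⟦ dec ⟧ (⟦singleton⟧ (M L) (⟦ singleton L ⟧ e)) ⟩
    inl (⟦ decode R ⟧ (⟦ unsingleton L ⟧ (⟦ singleton L ⟧ e)))
      ≡⟨ cong (λ v → inl (⟦ decode R ⟧ (⟦ unsingleton L ⟧ v))) (⟦singleton⟧ L e) ⟩
    inl (⟦ decode R ⟧ e)
      ≡⟨ cong inl (decode-encode R x) ⟩
    inl x ∎
    where e = ⟦ encode R ⟧ x
  dec-enc (inr y) = begin
    ⟦ dec ⟧ (⟦ doubleton (encode S ⨾ singleton L) (emptyOf τ L) ⟧ y)
      ≡⟨ cong ⟦ dec ⟧ (⟦doubleton⟧ (encode S ⨾ singleton L) (emptyOf τ L) y) ⟩
    ⟦ dec ⟧ (bag (⟦ singleton L ⟧ e ∷ ⟦ emptyOf τ L ⟧ y ∷ []))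
      ≡⟨ cong₂ (λ u v → ⟦ dec ⟧ (bag (u ∷ v ∷ []))) (⟦singleton⟧ L e) (⟦emptyOf⟧ τ L y) ⟩
    inr (⟦ decode S ⟧ (⟦ unsingleton L ⟧ (⟦ unionOfSingletons L ⟧ (bag (bag (e ∷ []) ∷ bag [] ∷ [])))))
      ≡⟨ cong (λ v → inr (⟦ decode S ⟧ (⟦ unsingleton L ⟧ v))) (⟦unionOfSingletons⟧ L e) ⟩
    inr (⟦ decode S ⟧ e)
      ≡⟨ cong inr (decode-encode S y) ⟩
    inr y ∎
    where e = ⟦ encode S ⟧ y

productRetract : ∀ {σ τ L} → Retract (σ ⊕ τ) L → Retract (σ ⊗ τ) (M L)
productRetract {σ} {τ} {L} R = record { encode = enc ; decode = dec ; decode-encode = dec-enc }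
  where
  enc : Der (σ ⊗ τ) (M L)
  enc = doubleton (π₁ ⨾ (ι₁ ⨾ encode R)) (π₂ ⨾ (ι₂ ⨾ encode R))

  dec : Der (M L) (σ ⊗ τ)
  dec = mapM (decode R) ⨾ ⟨ fromLeft σ τ , fromRight σ τ ⟩

  open ≡-Reasoning

  dec-enc : ∀ x → ⟦ dec ⟧ (⟦ enc ⟧ x) ≡ x
  dec-enc (pair a b) = begin
    ⟦ dec ⟧ (⟦ enc ⟧ (pair a b))
      ≡⟨ cong ⟦ dec ⟧ (⟦doubleton⟧ (π₁ ⨾ (ι₁ ⨾ encode R)) (π₂ ⨾ (ι₂ ⨾ encode R)) (pair a b)) ⟩
    ⟦ ⟨ fromLeft σ τ , fromRight σ τ ⟩ ⟧
      (bag (⟦ decode R ⟧ (⟦ encode R ⟧ (inl a)) ∷ ⟦ decode R ⟧ (⟦ encode R ⟧ (inr b)) ∷ []))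
      ≡⟨ cong₂ (λ u v → ⟦ ⟨ fromLeft σ τ , fromRight σ τ ⟩ ⟧ (bag (u ∷ v ∷ [])))
               (decode-encode R (inl a)) (decode-encode R (inr b)) ⟩
    pair (⟦ fromLeft σ τ ⟧ (bag (inl a ∷ inr b ∷ []))) (⟦ fromRight σ τ ⟧ (bag (inl a ∷ inr b ∷ [])))
      ≡⟨ cong₂ pair (⟦fromLeft⟧ a b) (⟦fromRight⟧ a b) ⟩
    pair a b ∎

raise : ∀ {σ k m} → Retract σ (Mpow k) → k ≤′ m → Retract σ (Mpow m)
raise R (≤′-reflexive ≡-refl) = R
raise R (≤′-step k≤′m)       = Retract-trans (raise R k≤′m) (singletonRetract _)

Encodable : Ty → Set
Encodable σ = Σ ℕ (λ k → Retract σ (Mpow k))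

encodable-⊕ : ∀ {σ τ} → Encodable σ → Encodable τ → Encodable (σ ⊕ τ)
encodable-⊕ (k , R) (l , S) =
  suc (suc (k ⊔ l)) , sumRetract (raise R (≤⇒≤′ (m≤m⊔n k l))) (raise S (≤⇒≤′ (m≤n⊔m k l)))

encodable-⊗ : ∀ {σ τ} → Encodable (σ ⊕ τ) → Encodable (σ ⊗ τ)
encodable-⊗ (k , R) = suc k , productRetract R

encodable-M : ∀ {σ} → Encodable σ → Encodable (M σ)
encodable-M (k , R) = suc k , mapRetract R

encodable : ∀ σ → Encodable σ
encodable 𝟙       = 0 , Retract-refl
encodable (σ ⊕ τ) = encodable-⊕ (encodable σ) (encodable τ)
encodable (σ ⊗ τ) = encodable-⊗ (encodable-⊕ (encodable σ) (encodable τ))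
encodable (M σ)   = encodable-M (encodable σ)

lemma4p10 : (σ : Ty) → Σ ℕ (λ k → Σ (Der σ (Mpow k)) (λ encode → Σ (Der (Mpow k) σ) (λ decode → (x : Val σ) → ⟦ encode ⨾ decode ⟧ x ≈ x)))
lemma4p10 σ with encodable σ
... | k , R = k , encode R , decode R , λ x → ≡⇒≈ (decode-encode R x)
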